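{- Let $\mathcal{C}$ and $\mathcal{D}$ be gs-monoidal categories and $F:\mathcal{C}\to\mathcal{D}$ a lax symmetric monoidal functor. If $\mathcal{D}$ is a Markov category, then $F$ is affine if and only if it is weakly affine and unital domain preserving.
   Context: Composition is diagrammatic ($f;g$ means first $f$, then $g$); the right unitor is $\rho_X:X\to X\otimes I$. A gs-monoidal category is a symmetric monoidal category with, for each object $X$, a discharger $!_X:X\to I$ and duplicator $\nabla_X:X\to X\otimes X$, compatible with the monoidal structure, with $\nabla_X$ coassociative, cocommutative, and $(X,\nabla_X,!_X)$ a comonoid. A Markov category is a gs-monoidal category in which every $f:X\to Y$ satisfies $f;!_Y=!_X$. $F$ has structure arrows $\psi_{X,Y}:F(X)\otimes F(Y)\to F(X\otimes Y)$, $\psi_0:I\to F(I)$. $F$ is affine if $F(!_X)=!_{F(X)};\psi_0$ for all $X$. $F$ is unital domain preserving if $\nabla_{F(I)};\psi_{I,I};F(\mathrm{id}_I\otimes !_I)=F(\rho_I)$. The triple $\langle F(I), \psi_{I,I};F(\rho^{ -1}_I), \psi_0\rangle$ is a commutative monoid object in $\mathcal{D}$; $F$ is weakly affine if this monoid object is a group object, i.e. there is an arrow $\iota:F(I)\to F(I)$ with $\nabla_{F(I)};(\mathrm{id}_{F(I)}\otimes\iota);\psi_{I,I};F(\rho^{ -1}_I)=!_{F(I)};\psi_0$. -}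

module Defs where

open import Level using (Level; _⊔_) renaming (suc to lsuc)
open import Relation.Binary.PropositionalEquality using (_≡_)
open import Data.Product using (Σ; _×_)

-- Composition is written diagrammatically:  f ⨾ g  means "first f, then g".
-- Equality of arrows is propositional equality on hom-types.

record SymmetricMonoidalCategory (o ℓ : Level) : Set (lsuc (o ⊔ ℓ)) where
  infixr 9 _⨾_
  infixr 10 _⊗₀_ _⊗₁_
  field
    Obj  : Set o
    _⇒_  : Obj → Obj → Set ℓ
    id   : ∀ {A} → A ⇒ A
    _⨾_  : ∀ {A B C} → A ⇒ B → B ⇒ C → A ⇒ C
    identityˡ : ∀ {A B} {f : A ⇒ B} → id ⨾ f ≡ f
    identityʳ : ∀ {A B} {f : A ⇒ B} → f ⨾ id ≡ f
    assoc     : ∀ {A B C D} {f : A ⇒ B} {g : B ⇒ C} {h : C ⇒ D} →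
                (f ⨾ g) ⨾ h ≡ f ⨾ (g ⨾ h)
    _⊗₀_ : Obj → Obj → Obj
    _⊗₁_ : ∀ {A B C D} → A ⇒ B → C ⇒ D → (A ⊗₀ C) ⇒ (B ⊗₀ D)
    ⊗-id : ∀ {A B} → id {A} ⊗₁ id {B} ≡ id
    ⊗-⨾  : ∀ {A B C D E F} {f : A ⇒ B} {g : B ⇒ C} {h : D ⇒ E} {k : E ⇒ F} →
           (f ⨾ g) ⊗₁ (h ⨾ k) ≡ (f ⊗₁ h) ⨾ (g ⊗₁ k)
    I : Obj
    α    : ∀ {A B C} → ((A ⊗₀ B) ⊗₀ C) ⇒ (A ⊗₀ (B ⊗₀ C))
    α⁻¹  : ∀ {A B C} → (A ⊗₀ (B ⊗₀ C)) ⇒ ((A ⊗₀ B) ⊗₀ C)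
    α-isoˡ : ∀ {A B C} → α {A} {B} {C} ⨾ α⁻¹ ≡ id
    α-isoʳ : ∀ {A B C} → α⁻¹ {A} {B} {C} ⨾ α ≡ id
    α-natural : ∀ {A B C D E F} {f : A ⇒ D} {g : B ⇒ E} {h : C ⇒ F} →
                ((f ⊗₁ g) ⊗₁ h) ⨾ α ≡ α ⨾ (f ⊗₁ (g ⊗₁ h))
    ρ    : ∀ {A} → A ⇒ (A ⊗₀ I)
    ρ⁻¹  : ∀ {A} → (A ⊗₀ I) ⇒ A
    ρ-isoˡ : ∀ {A} → ρ {A} ⨾ ρ⁻¹ ≡ id
    ρ-isoʳ : ∀ {A} → ρ⁻¹ {A} ⨾ ρ ≡ id
    ρ-natural : ∀ {A B} {f : A ⇒ B} → f ⨾ ρ ≡ ρ ⨾ (f ⊗₁ id)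
    λ'   : ∀ {A} → A ⇒ (I ⊗₀ A)
    λ'⁻¹ : ∀ {A} → (I ⊗₀ A) ⇒ A
    λ'-isoˡ : ∀ {A} → λ' {A} ⨾ λ'⁻¹ ≡ id
    λ'-isoʳ : ∀ {A} → λ'⁻¹ {A} ⨾ λ' ≡ id
    λ'-natural : ∀ {A B} {f : A ⇒ B} → f ⨾ λ' ≡ λ' ⨾ (id ⊗₁ f)
    σ : ∀ {A B} → (A ⊗₀ B) ⇒ (B ⊗₀ A)
    σ-natural : ∀ {A B C D} {f : A ⇒ C} {g : B ⇒ D} →
                (f ⊗₁ g) ⨾ σ ≡ σ ⨾ (g ⊗₁ f)
    σ-involutive : ∀ {A B} → σ {A} {B} ⨾ σ ≡ id
    pentagon : ∀ {A B C D} →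
               (α {A} {B} {C} ⊗₁ id {D}) ⨾ α ⨾ (id ⊗₁ α) ≡ α ⨾ α
    triangle : ∀ {A B} →
               α {A} {I} {B} ⨾ (id ⊗₁ λ'⁻¹) ≡ ρ⁻¹ ⊗₁ id
    hexagon  : ∀ {A B C} →
               α {A} {B} {C} ⨾ σ ⨾ α ≡ (σ ⊗₁ id) ⨾ α ⨾ (id ⊗₁ σ)

record GSMonoidalCategory (o ℓ : Level) : Set (lsuc (o ⊔ ℓ)) where
  field
    smc : SymmetricMonoidalCategory o ℓ
  open SymmetricMonoidalCategory smc public
  interchange : ∀ {A A' B B'} →
                ((A ⊗₀ A') ⊗₀ (B ⊗₀ B')) ⇒ ((A ⊗₀ B) ⊗₀ (A' ⊗₀ B'))
  interchange = α ⨾ (id ⊗₁ α⁻¹) ⨾ (id ⊗₁ (σ ⊗₁ id)) ⨾ (id ⊗₁ α) ⨾ α⁻¹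
  field
    !  : ∀ {A} → A ⇒ I
    ∇  : ∀ {A} → A ⇒ (A ⊗₀ A)
    ∇-coassoc : ∀ {A} → ∇ {A} ⨾ (∇ ⊗₁ id) ⨾ α ≡ ∇ ⨾ (id ⊗₁ ∇)
    ∇-counitʳ : ∀ {A} → ∇ {A} ⨾ (id ⊗₁ !) ≡ ρ
    ∇-counitˡ : ∀ {A} → ∇ {A} ⨾ (! ⊗₁ id) ≡ λ'
    ∇-cocomm  : ∀ {A} → ∇ {A} ⨾ σ ≡ ∇
    !-unit : ! {I} ≡ id
    !-⊗    : ∀ {A B} → ! {A ⊗₀ B} ≡ (! ⊗₁ !) ⨾ ρ⁻¹
    ∇-unit : ∇ {I} ≡ ρ
    ∇-⊗    : ∀ {A B} → ∇ {A ⊗₀ B} ≡ (∇ ⊗₁ ∇) ⨾ interchange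

IsMarkov : ∀ {o ℓ} → GSMonoidalCategory o ℓ → Set (o ⊔ ℓ)
IsMarkov D = ∀ {X Y} (f : X ⇒ Y) → f ⨾ ! ≡ !
  where open GSMonoidalCategory D

module _ {o ℓ o' ℓ'} (C : GSMonoidalCategory o ℓ) (D : GSMonoidalCategory o' ℓ') where
  private
    module C = GSMonoidalCategory C
    module D = GSMonoidalCategory D

  record LaxSymmetricMonoidalFunctor : Set (o ⊔ ℓ ⊔ o' ⊔ ℓ') where
    field
      F₀ : C.Obj → D.Obj
      F₁ : ∀ {A B} → A C.⇒ B → F₀ A D.⇒ F₀ B
      F-id : ∀ {A} → F₁ (C.id {A}) ≡ D.id
      F-⨾  : ∀ {A B E} {f : A C.⇒ B} {g : B C.⇒ E} →
             F₁ (f C.⨾ g) ≡ F₁ f D.⨾ F₁ g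
      ψ  : ∀ {A B} → (F₀ A D.⊗₀ F₀ B) D.⇒ F₀ (A C.⊗₀ B)
      ψ₀ : D.I D.⇒ F₀ C.I
      ψ-natural : ∀ {A B A' B'} {f : A C.⇒ A'} {g : B C.⇒ B'} →
                  (F₁ f D.⊗₁ F₁ g) D.⨾ ψ ≡ ψ D.⨾ F₁ (f C.⊗₁ g)
      ψ-assoc : ∀ {A B E} →
                (ψ {A} {B} D.⊗₁ D.id {F₀ E}) D.⨾ ψ D.⨾ F₁ C.α
                  ≡ D.α D.⨾ (D.id D.⊗₁ ψ) D.⨾ ψ
      ψ-unitʳ : ∀ {A} → D.ρ {F₀ A} D.⨾ (D.id D.⊗₁ ψ₀) D.⨾ ψ ≡ F₁ C.ρ
      ψ-unitˡ : ∀ {A} → D.λ' {F₀ A} D.⨾ (ψ₀ D.⊗₁ D.id) D.⨾ ψ ≡ F₁ C.λ'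
      ψ-symmetric : ∀ {A B} → D.σ D.⨾ ψ {B} {A} ≡ ψ D.⨾ F₁ C.σ

  module _ (F : LaxSymmetricMonoidalFunctor) where
    open LaxSymmetricMonoidalFunctor F

    Affine : Set (o ⊔ ℓ')
    Affine = ∀ {X} → F₁ (C.! {X}) ≡ D.! D.⨾ ψ₀

    UnitalDomainPreserving : Set ℓ'
    UnitalDomainPreserving =
      D.∇ D.⨾ ψ D.⨾ F₁ (C.id C.⊗₁ C.! {C.I}) ≡ F₁ (C.ρ {C.I})

    -- the commutative monoid ⟨F(I), ψ_{I,I} ⨾ F(ρ⁻¹_I), ψ₀⟩ is a group object:
    -- there is ι with ∇ ⨾ (id ⊗ ι) ⨾ ψ_{I,I} ⨾ F(ρ⁻¹_I) = ! ⨾ ψ₀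
    WeaklyAffine : Set ℓ'
    WeaklyAffine =
      Σ (F₀ C.I D.⇒ F₀ C.I) λ ι →
        D.∇ D.⨾ (D.id D.⊗₁ ι) D.⨾ ψ D.⨾ F₁ (C.ρ⁻¹ {C.I}) ≡ D.! D.⨾ ψ₀

{-# OPTIONS --safe #-}
module Submission where

-- Over a Markov category, F is affine exactly when id = ! ⨾ ψ₀ on F(I), since
-- then every arrow into F(I) equals ! ⨾ ψ₀; this trivial monoid is a group and
-- makes F unital domain preserving.  Conversely, unital domain preservation
-- says that the multiplication m of F(I) is idempotent, ∇ ⨾ m = id, and an
-- idempotent group is trivial: for the convolution f ⋆ g = ∇ ⨾ (f ⊗ g) ⨾ m,
--   id = id ⋆ (id ⋆ ι) = (id ⋆ id) ⋆ ι = id ⋆ ι = ! ⨾ ψ₀.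

open import Defs
open import Data.Product using (_×_; _,_)
open import Function.Bundles using (_⇔_; mk⇔; Equivalence)
open import Relation.Binary.PropositionalEquality
  using (_≡_; sym; trans; cong; cong₂; module ≡-Reasoning)
open ≡-Reasoning

module CategoryReasoning {o ℓ} (S : SymmetricMonoidalCategory o ℓ) where
  open SymmetricMonoidalCategory S

  private variable
    X Y : Obj
    f g h k l f' g' h' : X ⇒ Y

  assoc² : (f ⨾ g ⨾ h) ⨾ k ≡ f ⨾ g ⨾ h ⨾ k
  assoc² = trans assoc (cong (_ ⨾_) assoc)

  pullˡ : f ⨾ g ≡ h → f ⨾ g ⨾ k ≡ h ⨾ k
  pullˡ eq = trans (sym assoc) (cong (_⨾ _) eq)

  pull³ˡ : f ⨾ g ⨾ h ≡ k → f ⨾ g ⨾ h ⨾ l ≡ k ⨾ l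
  pull³ˡ eq = trans (sym assoc²) (cong (_⨾ _) eq)

  extend³ˡ : f ⨾ g ⨾ h ≡ f' ⨾ g' ⨾ h' → f ⨾ g ⨾ h ⨾ k ≡ f' ⨾ g' ⨾ h' ⨾ k
  extend³ˡ eq = trans (pull³ˡ eq) assoc²

  ⊗-split : f ⊗₁ g ≡ (f ⊗₁ id) ⨾ (id ⊗₁ g)
  ⊗-split = trans (cong₂ _⊗₁_ (sym identityʳ) (sym identityˡ)) ⊗-⨾

module GSMonoidalProperties {o ℓ} (C : GSMonoidalCategory o ℓ) where
  open GSMonoidalCategory C
  open CategoryReasoning smc

  private variable
    M X Y Z : Obj
    f g h k : X ⇒ Y

  -- Usually a consequence of coherence; here the comonoid on I gives it directly.
  λ'≡ρ-unit : λ' {I} ≡ ρ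
  λ'≡ρ-unit = begin
    λ'                      ≡⟨ sym ∇-counitˡ ⟩
    ∇ ⨾ (! ⊗₁ id)           ≡⟨ cong₂ (λ d e → d ⨾ (e ⊗₁ id)) ∇-unit !-unit ⟩
    ρ ⨾ (id ⊗₁ id)          ≡⟨ cong (ρ ⨾_) ⊗-id ⟩
    ρ ⨾ id                  ≡⟨ identityʳ ⟩
    ρ                       ∎

  λ'⁻¹≡ρ⁻¹-unit : λ'⁻¹ {I} ≡ ρ⁻¹
  λ'⁻¹≡ρ⁻¹-unit = begin
    λ'⁻¹                    ≡⟨ sym identityʳ ⟩
    λ'⁻¹ ⨾ id               ≡⟨ cong (λ'⁻¹ ⨾_) (sym ρ-isoˡ) ⟩
    λ'⁻¹ ⨾ ρ ⨾ ρ⁻¹          ≡⟨ cong (λ r → λ'⁻¹ ⨾ r ⨾ ρ⁻¹) (sym λ'≡ρ-unit) ⟩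
    λ'⁻¹ ⨾ λ' ⨾ ρ⁻¹         ≡⟨ pullˡ λ'-isoʳ ⟩
    id ⨾ ρ⁻¹                ≡⟨ identityˡ ⟩
    ρ⁻¹                     ∎

  ρ⁻¹-assoc-unit : (ρ⁻¹ {I} ⊗₁ id {I}) ⨾ ρ⁻¹ ≡ α ⨾ (id ⊗₁ ρ⁻¹) ⨾ ρ⁻¹
  ρ⁻¹-assoc-unit = begin
    (ρ⁻¹ ⊗₁ id) ⨾ ρ⁻¹           ≡⟨ cong (_⨾ ρ⁻¹) (sym triangle) ⟩
    (α ⨾ (id ⊗₁ λ'⁻¹)) ⨾ ρ⁻¹    ≡⟨ assoc ⟩
    α ⨾ (id ⊗₁ λ'⁻¹) ⨾ ρ⁻¹      ≡⟨ cong (λ l → α ⨾ (id ⊗₁ l) ⨾ ρ⁻¹) λ'⁻¹≡ρ⁻¹-unit ⟩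
    α ⨾ (id ⊗₁ ρ⁻¹) ⨾ ρ⁻¹       ∎

  id≡!⨾x⇒≡!⨾x : IsMarkov C → {x : I ⇒ X} → id ≡ ! ⨾ x → (f : Y ⇒ X) → f ≡ ! ⨾ x
  id≡!⨾x⇒≡!⨾x markov {x} id≡!⨾x f = begin
    f             ≡⟨ sym identityʳ ⟩
    f ⨾ id        ≡⟨ cong (f ⨾_) id≡!⨾x ⟩
    f ⨾ ! ⨾ x     ≡⟨ pullˡ (markov f) ⟩
    ! ⨾ x         ∎

  ⟪_,_⟫ : X ⇒ Y → X ⇒ Z → X ⇒ (Y ⊗₀ Z)
  ⟪ f , g ⟫ = ∇ ⨾ (f ⊗₁ g)

  ⟪,⟫-⨾-⊗ : ⟪ f , g ⟫ ⨾ (h ⊗₁ k) ≡ ⟪ f ⨾ h , g ⨾ k ⟫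
  ⟪,⟫-⨾-⊗ = trans assoc (cong (∇ ⨾_) (sym ⊗-⨾))

  ⟪id,id⟫≡∇ : ⟪ id {X} , id ⟫ ≡ ∇
  ⟪id,id⟫≡∇ = trans (cong (∇ ⨾_) ⊗-id) identityʳ

  ⟪,!⨾⟫ : {x : I ⇒ Z} → ⟪ f , ! ⨾ x ⟫ ≡ f ⨾ ρ ⨾ (id ⊗₁ x)
  ⟪,!⨾⟫ {f = f} {x = x} = begin
    ⟪ f , ! ⨾ x ⟫               ≡⟨ cong ⟪_, ! ⨾ x ⟫ (sym identityˡ) ⟩
    ⟪ id ⨾ f , ! ⨾ x ⟫          ≡⟨ sym ⟪,⟫-⨾-⊗ ⟩
    ⟪ id , ! ⟫ ⨾ (f ⊗₁ x)       ≡⟨ cong₂ _⨾_ ∇-counitʳ ⊗-split ⟩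
    ρ ⨾ (f ⊗₁ id) ⨾ (id ⊗₁ x)   ≡⟨ pullˡ (sym ρ-natural) ⟩
    (f ⨾ ρ) ⨾ (id ⊗₁ x)         ≡⟨ assoc ⟩
    f ⨾ ρ ⨾ (id ⊗₁ x)           ∎

  ⟪⟪,⟫,⟫-⨾-α : ⟪ ⟪ f , g ⟫ , h ⟫ ⨾ α ≡ ⟪ f , ⟪ g , h ⟫ ⟫
  ⟪⟪,⟫,⟫-⨾-α {f = f} {g = g} {h = h} = begin
    ⟪ ⟪ f , g ⟫ , h ⟫ ⨾ α                ≡⟨ cong (λ k → ⟪ ⟪ f , g ⟫ , k ⟫ ⨾ α) (sym identityˡ) ⟩
    ⟪ ∇ ⨾ (f ⊗₁ g) , id ⨾ h ⟫ ⨾ α        ≡⟨ cong (_⨾ α) (sym ⟪,⟫-⨾-⊗) ⟩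
    (⟪ ∇ , id ⟫ ⨾ ((f ⊗₁ g) ⊗₁ h)) ⨾ α   ≡⟨ assoc ⟩
    ⟪ ∇ , id ⟫ ⨾ ((f ⊗₁ g) ⊗₁ h) ⨾ α     ≡⟨ cong (⟪ ∇ , id ⟫ ⨾_) α-natural ⟩
    ⟪ ∇ , id ⟫ ⨾ α ⨾ (f ⊗₁ (g ⊗₁ h))     ≡⟨ pullˡ (trans assoc ∇-coassoc) ⟩
    ⟪ id , ∇ ⟫ ⨾ (f ⊗₁ (g ⊗₁ h))         ≡⟨ ⟪,⟫-⨾-⊗ ⟩
    ⟪ id ⨾ f , ⟪ g , h ⟫ ⟫               ≡⟨ cong ⟪_, ⟪ g , h ⟫ ⟫ identityˡ ⟩
    ⟪ f , ⟪ g , h ⟫ ⟫                    ∎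

  module Convolution (m : (M ⊗₀ M) ⇒ M) (e : I ⇒ M) where
    infixl 8 _⋆_
    _⋆_ : X ⇒ M → X ⇒ M → X ⇒ M
    f ⋆ g = ⟪ f , g ⟫ ⨾ m

    ⋆-identityʳ : ρ ⨾ (id ⊗₁ e) ⨾ m ≡ id → (f : X ⇒ M) → f ⋆ (! ⨾ e) ≡ f
    ⋆-identityʳ m-identityʳ f = begin
      ⟪ f , ! ⨾ e ⟫ ⨾ m             ≡⟨ cong (_⨾ m) ⟪,!⨾⟫ ⟩
      (f ⨾ ρ ⨾ (id ⊗₁ e)) ⨾ m       ≡⟨ assoc² ⟩
      f ⨾ ρ ⨾ (id ⊗₁ e) ⨾ m         ≡⟨ cong (f ⨾_) m-identityʳ ⟩
      f ⨾ id                        ≡⟨ identityʳ ⟩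
      f                             ∎

    ⋆-assoc : (m ⊗₁ id) ⨾ m ≡ α ⨾ (id ⊗₁ m) ⨾ m →
              (f g h : X ⇒ M) → f ⋆ g ⋆ h ≡ f ⋆ (g ⋆ h)
    ⋆-assoc m-assoc f g h = begin
      ⟪ ⟪ f , g ⟫ ⨾ m , h ⟫ ⨾ m              ≡⟨ cong (λ k → ⟪ ⟪ f , g ⟫ ⨾ m , k ⟫ ⨾ m) (sym identityʳ) ⟩
      ⟪ ⟪ f , g ⟫ ⨾ m , h ⨾ id ⟫ ⨾ m         ≡⟨ cong (_⨾ m) (sym ⟪,⟫-⨾-⊗) ⟩
      (⟪ ⟪ f , g ⟫ , h ⟫ ⨾ (m ⊗₁ id)) ⨾ m    ≡⟨ assoc ⟩
      ⟪ ⟪ f , g ⟫ , h ⟫ ⨾ (m ⊗₁ id) ⨾ m      ≡⟨ cong (⟪ ⟪ f , g ⟫ , h ⟫ ⨾_) m-assoc ⟩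
      ⟪ ⟪ f , g ⟫ , h ⟫ ⨾ α ⨾ (id ⊗₁ m) ⨾ m  ≡⟨ pullˡ ⟪⟪,⟫,⟫-⨾-α ⟩
      ⟪ f , ⟪ g , h ⟫ ⟫ ⨾ (id ⊗₁ m) ⨾ m      ≡⟨ pullˡ ⟪,⟫-⨾-⊗ ⟩
      ⟪ f ⨾ id , ⟪ g , h ⟫ ⨾ m ⟫ ⨾ m         ≡⟨ cong (λ k → ⟪ k , ⟪ g , h ⟫ ⨾ m ⟫ ⨾ m) identityʳ ⟩
      ⟪ f , ⟪ g , h ⟫ ⨾ m ⟫ ⨾ m              ∎

    idempotent-invertible⇒id≡!⨾e :
      ρ ⨾ (id ⊗₁ e) ⨾ m ≡ id → (m ⊗₁ id) ⨾ m ≡ α ⨾ (id ⊗₁ m) ⨾ m →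
      ∇ ⨾ m ≡ id → {ι : M ⇒ M} → id ⋆ ι ≡ ! ⨾ e → id ≡ ! ⨾ e
    idempotent-invertible⇒id≡!⨾e m-identityʳ m-assoc idempotent {ι} inverse = begin
      id                  ≡⟨ sym (⋆-identityʳ m-identityʳ id) ⟩
      id ⋆ (! ⨾ e)        ≡⟨ cong (id ⋆_) (sym inverse) ⟩
      id ⋆ (id ⋆ ι)       ≡⟨ sym (⋆-assoc m-assoc id id ι) ⟩
      id ⋆ id ⋆ ι         ≡⟨ cong (λ k → (k ⨾ m) ⋆ ι) ⟪id,id⟫≡∇ ⟩
      (∇ ⨾ m) ⋆ ι         ≡⟨ cong (_⋆ ι) idempotent ⟩
      id ⋆ ι              ≡⟨ inverse ⟩
      ! ⨾ e               ∎

module LaxMonoidalFunctorProperties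
    {o ℓ o' ℓ'} {C : GSMonoidalCategory o ℓ} {D : GSMonoidalCategory o' ℓ'}
    (F : LaxSymmetricMonoidalFunctor C D) where
  private
    module C = GSMonoidalCategory C
    module D = GSMonoidalCategory D
  open LaxSymmetricMonoidalFunctor F
  open D using (_⨾_; _⊗₁_; _⊗₀_; _⇒_; id; !; ∇; ρ; α)
  open CategoryReasoning D.smc
  open GSMonoidalProperties D hiding (ρ⁻¹-assoc-unit)
  open GSMonoidalProperties C using (ρ⁻¹-assoc-unit)

  private variable
    A A' B B' E : C.Obj
    X Y : D.Obj

  μ : (F₀ C.I ⊗₀ F₀ C.I) ⇒ F₀ C.I
  μ = ψ ⨾ F₁ C.ρ⁻¹

  F-ρ-iso : F₁ (C.ρ {A}) ⨾ F₁ C.ρ⁻¹ ≡ id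
  F-ρ-iso = trans (sym F-⨾) (trans (cong F₁ C.ρ-isoˡ) F-id)

  F-!-unit : F₁ (C.! {C.I}) ≡ id
  F-!-unit = trans (cong F₁ C.!-unit) F-id

  F-id⊗!-unit : F₁ (C.id {C.I} C.⊗₁ C.! {C.I}) ≡ id
  F-id⊗!-unit = begin
    F₁ (C.id C.⊗₁ C.!)    ≡⟨ cong (λ d → F₁ (C.id C.⊗₁ d)) C.!-unit ⟩
    F₁ (C.id C.⊗₁ C.id)   ≡⟨ cong F₁ C.⊗-id ⟩
    F₁ C.id               ≡⟨ F-id ⟩
    id                    ∎

  id≡id⨾F-id : id {F₀ A} ≡ id ⨾ F₁ C.id
  id≡id⨾F-id = sym (trans D.identityˡ F-id)

  ψ-natural-⨾ : {a : X ⇒ F₀ A} {b : Y ⇒ F₀ B} {f : A C.⇒ A'} {g : B C.⇒ B'}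
                {h : (A' C.⊗₀ B') C.⇒ E} →
                ((a ⨾ F₁ f) ⊗₁ (b ⨾ F₁ g)) ⨾ ψ ⨾ F₁ h ≡ (a ⊗₁ b) ⨾ ψ ⨾ F₁ ((f C.⊗₁ g) C.⨾ h)
  ψ-natural-⨾ {a = a} {b} {f} {g} {h} = begin
    ((a ⨾ F₁ f) ⊗₁ (b ⨾ F₁ g)) ⨾ ψ ⨾ F₁ h        ≡⟨ cong (_⨾ ψ ⨾ F₁ h) D.⊗-⨾ ⟩
    ((a ⊗₁ b) ⨾ (F₁ f ⊗₁ F₁ g)) ⨾ ψ ⨾ F₁ h       ≡⟨ D.assoc ⟩
    (a ⊗₁ b) ⨾ (F₁ f ⊗₁ F₁ g) ⨾ ψ ⨾ F₁ h         ≡⟨ cong ((a ⊗₁ b) ⨾_) (trans (pullˡ ψ-natural) D.assoc) ⟩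
    (a ⊗₁ b) ⨾ ψ ⨾ F₁ (f C.⊗₁ g) ⨾ F₁ h          ≡⟨ cong (λ k → (a ⊗₁ b) ⨾ ψ ⨾ k) (sym F-⨾) ⟩
    (a ⊗₁ b) ⨾ ψ ⨾ F₁ ((f C.⊗₁ g) C.⨾ h)         ∎

  ⟪id,!⨾ψ₀⟫⨾ψ : ⟪ id , ! ⨾ ψ₀ ⟫ ⨾ ψ ≡ F₁ (C.ρ {A})
  ⟪id,!⨾ψ₀⟫⨾ψ = begin
    ⟪ id , ! ⨾ ψ₀ ⟫ ⨾ ψ           ≡⟨ cong (_⨾ ψ) ⟪,!⨾⟫ ⟩
    (id ⨾ ρ ⨾ (id ⊗₁ ψ₀)) ⨾ ψ    ≡⟨ cong (_⨾ ψ) D.identityˡ ⟩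
    (ρ ⨾ (id ⊗₁ ψ₀)) ⨾ ψ         ≡⟨ D.assoc ⟩
    ρ ⨾ (id ⊗₁ ψ₀) ⨾ ψ           ≡⟨ ψ-unitʳ ⟩
    F₁ C.ρ                       ∎

  μ-identityʳ : ρ ⨾ (id ⊗₁ ψ₀) ⨾ μ ≡ id
  μ-identityʳ = trans (pull³ˡ ψ-unitʳ) F-ρ-iso

  μ-assoc : (μ ⊗₁ id) ⨾ μ ≡ α ⨾ (id ⊗₁ μ) ⨾ μ
  μ-assoc = begin
    ((ψ ⨾ F₁ C.ρ⁻¹) ⊗₁ id) ⨾ ψ ⨾ F₁ C.ρ⁻¹
      ≡⟨ cong (λ k → ((ψ ⨾ F₁ C.ρ⁻¹) ⊗₁ k) ⨾ ψ ⨾ F₁ C.ρ⁻¹) id≡id⨾F-id ⟩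
    ((ψ ⨾ F₁ C.ρ⁻¹) ⊗₁ (id ⨾ F₁ C.id)) ⨾ ψ ⨾ F₁ C.ρ⁻¹
      ≡⟨ ψ-natural-⨾ ⟩
    (ψ ⊗₁ id) ⨾ ψ ⨾ F₁ ((C.ρ⁻¹ C.⊗₁ C.id) C.⨾ C.ρ⁻¹)
      ≡⟨ cong (λ k → (ψ ⊗₁ id) ⨾ ψ ⨾ F₁ k) ρ⁻¹-assoc-unit ⟩
    (ψ ⊗₁ id) ⨾ ψ ⨾ F₁ (C.α C.⨾ (C.id C.⊗₁ C.ρ⁻¹) C.⨾ C.ρ⁻¹)
      ≡⟨ cong (λ k → (ψ ⊗₁ id) ⨾ ψ ⨾ k) F-⨾ ⟩
    (ψ ⊗₁ id) ⨾ ψ ⨾ F₁ C.α ⨾ F₁ ((C.id C.⊗₁ C.ρ⁻¹) C.⨾ C.ρ⁻¹)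
      ≡⟨ extend³ˡ ψ-assoc ⟩
    α ⨾ (id ⊗₁ ψ) ⨾ ψ ⨾ F₁ ((C.id C.⊗₁ C.ρ⁻¹) C.⨾ C.ρ⁻¹)
      ≡⟨ cong (α ⨾_) (sym ψ-natural-⨾) ⟩
    α ⨾ ((id ⨾ F₁ C.id) ⊗₁ (ψ ⨾ F₁ C.ρ⁻¹)) ⨾ ψ ⨾ F₁ C.ρ⁻¹
      ≡⟨ cong (λ k → α ⨾ (k ⊗₁ (ψ ⨾ F₁ C.ρ⁻¹)) ⨾ ψ ⨾ F₁ C.ρ⁻¹) (sym id≡id⨾F-id) ⟩
    α ⨾ (id ⊗₁ (ψ ⨾ F₁ C.ρ⁻¹)) ⨾ ψ ⨾ F₁ C.ρ⁻¹
      ∎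

  unitalDomainPreserving⇔∇⨾ψ≡Fρ : UnitalDomainPreserving C D F ⇔ (∇ ⨾ ψ ≡ F₁ C.ρ)
  unitalDomainPreserving⇔∇⨾ψ≡Fρ = mk⇔ (trans (sym drop)) (trans drop)
    where
    drop : ∇ ⨾ ψ ⨾ F₁ (C.id C.⊗₁ C.!) ≡ ∇ ⨾ ψ
    drop = trans (cong (λ k → ∇ ⨾ ψ ⨾ k) F-id⊗!-unit) (cong (∇ ⨾_) D.identityʳ)

  affine⇒id≡!⨾ψ₀ : Affine C D F → id ≡ ! ⨾ ψ₀
  affine⇒id≡!⨾ψ₀ affine = trans (sym F-!-unit) affine

  id≡!⨾ψ₀⇒affine : IsMarkov D → id ≡ ! ⨾ ψ₀ → Affine C D F
  id≡!⨾ψ₀⇒affine markov id≡!⨾ψ₀ = id≡!⨾x⇒≡!⨾x markov id≡!⨾ψ₀ (F₁ C.!)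

  id≡!⨾ψ₀⇒weaklyAffine : IsMarkov D → id ≡ ! ⨾ ψ₀ → WeaklyAffine C D F
  id≡!⨾ψ₀⇒weaklyAffine markov id≡!⨾ψ₀ = id , id≡!⨾x⇒≡!⨾x markov id≡!⨾ψ₀ _

  id≡!⨾ψ₀⇒unitalDomainPreserving : id ≡ ! ⨾ ψ₀ → UnitalDomainPreserving C D F
  id≡!⨾ψ₀⇒unitalDomainPreserving id≡!⨾ψ₀ = Equivalence.from unitalDomainPreserving⇔∇⨾ψ≡Fρ (begin
    ∇ ⨾ ψ                  ≡⟨ cong (_⨾ ψ) (sym ⟪id,id⟫≡∇) ⟩
    ⟪ id , id ⟫ ⨾ ψ        ≡⟨ cong (λ k → ⟪ id , k ⟫ ⨾ ψ) id≡!⨾ψ₀ ⟩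
    ⟪ id , ! ⨾ ψ₀ ⟫ ⨾ ψ    ≡⟨ ⟪id,!⨾ψ₀⟫⨾ψ ⟩
    F₁ C.ρ                 ∎)

  weaklyAffine⇒unitalDomainPreserving⇒id≡!⨾ψ₀ :
    WeaklyAffine C D F → UnitalDomainPreserving C D F → id ≡ ! ⨾ ψ₀
  weaklyAffine⇒unitalDomainPreserving⇒id≡!⨾ψ₀ (_ , inverse) udp =
    idempotent-invertible⇒id≡!⨾e μ-identityʳ μ-assoc idempotent (trans D.assoc inverse)
    where
    open Convolution μ ψ₀
    idempotent : ∇ ⨾ μ ≡ id
    idempotent = trans (pullˡ (Equivalence.to unitalDomainPreserving⇔∇⨾ψ≡Fρ udp)) F-ρ-iso

proposition5p11 : ∀ {o ℓ o' ℓ'} (C : GSMonoidalCategory o ℓ) (D : GSMonoidalCategory o' ℓ')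
                    (F : LaxSymmetricMonoidalFunctor C D) →
                    IsMarkov D →
                    Affine C D F ⇔ (WeaklyAffine C D F × UnitalDomainPreserving C D F)
proposition5p11 C D F markov = mk⇔
  (λ (affine : Affine C D F) → let trivial = affine⇒id≡!⨾ψ₀ affine in
    id≡!⨾ψ₀⇒weaklyAffine markov trivial , id≡!⨾ψ₀⇒unitalDomainPreserving trivial)
  (λ (weaklyAffine , udp) →
    id≡!⨾ψ₀⇒affine markov (weaklyAffine⇒unitalDomainPreserving⇒id≡!⨾ψ₀ weaklyAffine udp))
  where open LaxMonoidalFunctorProperties F
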